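{- Let $e$ be the number of edges of a compact automaton $\mathcal A$ recognizing all (and only the) suffixes of a string $T$. Then $T$ has a string attractor of size $e$.
   Context: A string attractor of a string $T$ of length $n$ is a set $\Gamma\subseteq\{1,\dots,n\}$ such that every substring $T[i..j]$ has an occurrence $T[i'..j']=T[i..j]$ with $p\in[i',j']$ for some $p\in\Gamma$. A compact automaton here is a path-compressed deterministic directed acyclic graph with a source node (the initial state), whose edges are labeled by non-empty strings (edges leaving the same node start with distinct characters), such that the strings spelled by paths from the source to the sink (final) node are exactly the suffixes of $T$; in particular every substring of $T$ is spelled by a path from the source, possibly ending inside an edge label (e.g., the CDAWG of $T$). -}

module Defs where

open import Data.Nat using (ℕ; suc; _≤_; _<_; _∸_)
open import Data.Fin using (Fin)
open import Data.List using (List; []; _∷_; _++_; length; take; drop)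
open import Data.List.Membership.Propositional using (_∈_)
open import Data.List.Relation.Unary.All using (All)
open import Data.Product using (Σ; _×_; ∃)
open import Relation.Binary.PropositionalEquality using (_≡_)

-- Strings are lists over an arbitrary alphabet A; positions are 0-based,
-- i.e. position p ∈ {0,…,n-1} corresponds to position p+1 of the paper.

-- substring T[i..j] (0-based, inclusive), meaningful for i ≤ j < length T
substr : {A : Set} → List A → ℕ → ℕ → List A
substr T i j = take (suc j ∸ i) (drop i T)

-- Γ is a string attractor of T (Γ given as a list of positions; it denotes
-- the set of its elements)
IsStringAttractor : {A : Set} → List A → List ℕ → Set
IsStringAttractor T Γ =
  All (λ p → p < length T) Γ ×
  (∀ i j → i ≤ j → j < length T →
     Σ ℕ λ i' → Σ ℕ λ j' →
       i' ≤ j' × j' < length T × substr T i' j' ≡ substr T i j ×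
       Σ ℕ λ p → p ∈ Γ × i' ≤ p × p ≤ j')

IsSuffix : {A : Set} → List A → List A → Set
IsSuffix w T = Σ ℕ λ i → i < length T × w ≡ drop i T

-- A compact automaton over alphabet A: nodes Fin nodes, edges Fin edges.
-- Edge k goes from src k to tgt k and is labelled by the non-empty string
-- fst k ∷ rest k.
record CompactAutomaton (A : Set) : Set where
  field
    nodes  : ℕ
    edges  : ℕ
    source : Fin nodes
    sink   : Fin nodes
    src    : Fin edges → Fin nodes
    tgt    : Fin edges → Fin nodes
    fst    : Fin edges → A
    rest   : Fin edges → List A

  label : Fin edges → List A
  label k = fst k ∷ rest k

  data Path : Fin nodes → Fin nodes → List A → Set where
    nil  : ∀ {q} → Path q q []
    cons : ∀ {q r w} (k : Fin edges) → src k ≡ q → Path (tgt k) r w →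
           Path q r (label k ++ w)

  Deterministic : Set
  Deterministic = ∀ k l → src k ≡ src l → fst k ≡ fst l → k ≡ l

  Acyclic : Set
  Acyclic = ∀ q w → Path q q w → w ≡ []

  RecognizesSuffixes : List A → Set
  RecognizesSuffixes T =
    (∀ w → Path source sink w → IsSuffix w T) ×
    (∀ w → IsSuffix w T → Path source sink w)

IsCompactAutomatonFor : {A : Set} → CompactAutomaton A → List A → Set
IsCompactAutomatonFor 𝒜 T =
  Deterministic × Acyclic × RecognizesSuffixes T
  where open CompactAutomaton 𝒜

-- Every substring u of T is a prefix of some suffix, so it is spelled by a path from the
-- source and its last character lies on the label of some edge k.  Fix, once and for all,
-- a path from the target of k to the sink, spelling z_k.  Re-routing the path for u through
-- z_k after k yields a suffix of T in which u occurs with the first character of k at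
-- position |T| − |label k| − |z_k|, which depends on k alone.  These e positions therefore
-- form a string attractor.
module Submission where

open import Defs
open import Data.Nat using (ℕ; zero; suc; _≤_; _<_; _+_; _∸_; z≤n; s≤s; _<?_)
open import Data.Nat.Properties
open import Data.List using (List; []; _∷_; _++_; length; take; drop; tabulate; filter)
open import Data.List.Properties
  using (∷-injective; ++-identityʳ; ++-assoc; length-++; length-drop; take++drop≡id; length-filter; length-tabulate)
open import Data.List.Membership.Propositional using (_∈_)
open import Data.List.Membership.Propositional.Properties using (∈-tabulate⁺; ∈-filter⁺)
open import Data.List.Relation.Unary.All.Properties using (all-filter)
open import Data.Fin using (Fin)
open import Data.Fin.Properties using (any?) renaming (_≟_ to _≟ᶠ_)
open import Data.Product using (Σ; ∃; _×_; _,_; proj₁; proj₂)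
open import Data.Sum using (_⊎_; inj₁; inj₂)
open import Relation.Nullary using (Dec; yes; no; contradiction)
open import Relation.Nullary.Decidable using (map′; _×-dec_)
open import Relation.Binary.PropositionalEquality

module _ {A : Set} where

  ++-≡-++ : (as bs cs ds : List A) → as ++ bs ≡ cs ++ ds →
    (∃ λ m → cs ≡ as ++ m × bs ≡ m ++ ds) ⊎ (∃ λ m → as ≡ cs ++ m × ds ≡ m ++ bs)
  ++-≡-++ []       bs cs       ds eq = inj₁ (cs , refl , eq)
  ++-≡-++ (a ∷ as) bs []       ds eq = inj₂ (a ∷ as , refl , sym eq)
  ++-≡-++ (a ∷ as) bs (c ∷ cs) ds eq with ∷-injective eq
  ... | refl , eq′ with ++-≡-++ as bs cs ds eq′
  ... | inj₁ (m , p , q) = inj₁ (m , cong (a ∷_) p , q)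
  ... | inj₂ (m , p , q) = inj₂ (m , cong (a ∷_) p , q)

  take-length-++ : (xs ys : List A) → take (length xs) (xs ++ ys) ≡ xs
  take-length-++ []       ys = refl
  take-length-++ (x ∷ xs) ys = cong (x ∷_) (take-length-++ xs ys)

  length-≤-length-++ : (xs ys : List A) → length ys ≤ length (xs ++ ys)
  length-≤-length-++ xs ys = subst (length ys ≤_) (sym (length-++ xs)) (m≤n+m (length ys) (length xs))

  ∷≡++∷⇒length≤ : ∀ {c d : A} us xs ys → c ∷ us ≡ xs ++ d ∷ ys → length xs ≤ length us
  ∷≡++∷⇒length≤ us       []       ys eq = z≤n
  ∷≡++∷⇒length≤ (u ∷ us) (x ∷ xs) ys eq = s≤s (∷≡++∷⇒length≤ us xs ys (proj₂ (∷-injective eq)))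
  ∷≡++∷⇒length≤ []       (x ∷ []) ys ()
  ∷≡++∷⇒length≤ []       (x ∷ x′ ∷ xs) ys ()

  drop-≡-∷⇒< : ∀ (T : List A) i {c w} → drop i T ≡ c ∷ w → i + length w < length T
  drop-≡-∷⇒< []      zero    ()
  drop-≡-∷⇒< []      (suc i) ()
  drop-≡-∷⇒< (a ∷ T) zero    refl = n<1+n (length T)
  drop-≡-∷⇒< (a ∷ T) (suc i) eq   = s≤s (drop-≡-∷⇒< T i eq)

  drop-nonempty : ∀ (T : List A) i → i < length T → ∃ λ c → ∃ λ s → drop i T ≡ c ∷ s
  drop-nonempty (a ∷ T) zero    _         = a , T , refl
  drop-nonempty (a ∷ T) (suc i) (s≤s i<n) = drop-nonempty T i i<n

  substr-split : ∀ (T : List A) {i j} → i ≤ j → j < length T →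
    ∃ λ c → ∃ λ us → ∃ λ v → substr T i j ≡ c ∷ us × drop i T ≡ (c ∷ us) ++ v
  substr-split T {i} {j} i≤j j<n with drop-nonempty T i (≤-<-trans i≤j j<n)
  ... | c , s , drop≡ = c , take (j ∸ i) s , drop (j ∸ i) s , substr≡ , drop≡′
    where
    substr≡ : substr T i j ≡ c ∷ take (j ∸ i) s
    substr≡ = cong₂ take (+-∸-assoc 1 i≤j) drop≡
    drop≡′ : drop i T ≡ (c ∷ take (j ∸ i) s) ++ drop (j ∸ i) s
    drop≡′ = trans drop≡ (cong (c ∷_) (sym (take++drop≡id (j ∸ i) s)))

  occurrence-substr : ∀ (T : List A) i {c us v} → drop i T ≡ (c ∷ us) ++ v →
    i + length us < length T × substr T i (i + length us) ≡ c ∷ us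
  occurrence-substr T i {c} {us} {v} drop≡ = bound , substr≡
    where
    open ≡-Reasoning
    bound : i + length us < length T
    bound = ≤-<-trans (+-monoʳ-≤ i (m≤m+n (length us) (length v)))
              (subst (λ l → i + l < length T) (length-++ us) (drop-≡-∷⇒< T i drop≡))
    substr≡ : substr T i (i + length us) ≡ c ∷ us
    substr≡ = begin
      take (suc (i + length us) ∸ i) (drop i T) ≡⟨ cong₂ take (trans (cong (_∸ i) (sym (+-suc i _))) (m+n∸m≡n i _)) drop≡ ⟩
      c ∷ take (length us) (us ++ v)             ≡⟨ cong (c ∷_) (take-length-++ us v) ⟩
      c ∷ us                                     ∎

  drop-offset : ∀ (T : List A) {i} xs ys → i ≤ length T → drop i T ≡ xs ++ ys →
    i + length xs ≡ length T ∸ length ys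
  drop-offset T {i} xs ys i≤n drop≡ = begin
    i + length xs                        ≡⟨ m+n∸n≡m (i + length xs) (length ys) ⟨
    i + length xs + length ys ∸ length ys ≡⟨ cong (_∸ length ys) whole ⟩
    length T ∸ length ys                 ∎
    where
    open ≡-Reasoning
    whole : i + length xs + length ys ≡ length T
    whole = begin
      i + length xs + length ys ≡⟨ +-assoc i (length xs) (length ys) ⟩
      i + (length xs + length ys) ≡⟨ cong (i +_) (length-++ xs) ⟨
      i + length (xs ++ ys)       ≡⟨ cong (λ w → i + length w) drop≡ ⟨
      i + length (drop i T)       ≡⟨ cong (i +_) (length-drop i T) ⟩
      i + (length T ∸ i)          ≡⟨ m+[n∸m]≡n i≤n ⟩
      length T                    ∎

  suffix-length≤ : ∀ {w T : List A} → IsSuffix w T → length w ≤ length T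
  suffix-length≤ {T = T} (i , _ , refl) = subst (_≤ length T) (sym (length-drop i T)) (m∸n≤m (length T) i)

module _ {A : Set} (𝒜 : CompactAutomaton A) where
  open CompactAutomaton 𝒜

  edgeCount : ∀ {q r w} → Path q r w → ℕ
  edgeCount nil          = 0
  edgeCount (cons _ _ P) = suc (edgeCount P)

  edgeCount≤length : ∀ {q r w} (P : Path q r w) → edgeCount P ≤ length w
  edgeCount≤length nil = z≤n
  edgeCount≤length (cons {w = w} k _ P) =
    s≤s (≤-trans (edgeCount≤length P) (length-≤-length-++ (rest k) w))

  _++ᵖ_ : ∀ {q r s x y} → Path q r x → Path r s y → Path q s (x ++ y)
  nil ++ᵖ Q = Q
  _++ᵖ_ {y = y} (cons k e P) Q = subst (Path _ _) (sym (++-assoc (label k) _ y)) (cons k e (P ++ᵖ Q))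

  -- Bounding the number of edges makes reachability decidable by search; the bound |T|
  -- suffices because edge labels are non-empty (edgeCount≤length).
  ReachesSinkWithin : ℕ → Fin nodes → Set
  ReachesSinkWithin f q = Σ (List A) λ z → Σ (Path q sink z) λ P → edgeCount P ≤ f

  reachesSinkWithin? : ∀ f q → Dec (ReachesSinkWithin f q)
  reachesSinkWithin? f q with q ≟ᶠ sink
  ... | yes refl = yes ([] , nil , z≤n)
  reachesSinkWithin? zero    q | no q≢sink = no λ { (_ , nil , _) → q≢sink refl ; (_ , cons _ _ _ , ()) }
  reachesSinkWithin? (suc f) q | no q≢sink =
    map′ viaEdge firstEdge (any? λ k → src k ≟ᶠ q ×-dec reachesSinkWithin? f (tgt k))
    where
    viaEdge : (∃ λ k → src k ≡ q × ReachesSinkWithin f (tgt k)) → ReachesSinkWithin (suc f) q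
    viaEdge (k , e , z , P , P≤f) = label k ++ z , cons k e P , s≤s P≤f
    firstEdge : ReachesSinkWithin (suc f) q → ∃ λ k → src k ≡ q × ReachesSinkWithin f (tgt k)
    firstEdge (_ , nil , _)              = contradiction refl q≢sink
    firstEdge (_ , cons k e P , s≤s P≤f) = k , e , _ , P , P≤f

  tailLength : ℕ → Fin nodes → ℕ
  tailLength f q with reachesSinkWithin? f q
  ... | yes (z , _) = length z
  ... | no _        = 0

  chosenTail : ∀ f q → ReachesSinkWithin f q → Σ (List A) λ z → Path q sink z × length z ≡ tailLength f q
  chosenTail f q reach with reachesSinkWithin? f q
  ... | yes (z , P , _) = z , P , refl
  ... | no ¬reach       = contradiction reach ¬reach

  record EndsInside (q r : Fin nodes) (w u : List A) : Set where
    constructor endsInside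
    field
      k                                : Fin edges
      before inEdge afterInEdge beyond : List A
      pathBefore                       : Path q (src k) before
      pathBeyond                       : Path (tgt k) r beyond
      rest≡                            : inEdge ++ afterInEdge ≡ rest k
      prefix≡                          : u ≡ before ++ fst k ∷ inEdge
      word≡                            : w ≡ before ++ label k ++ beyond

  prefixEndsInside : ∀ {q r w c us v} → Path q r w → w ≡ (c ∷ us) ++ v → EndsInside q r w (c ∷ us)
  prefixEndsInside nil ()
  prefixEndsInside {us = us} {v} (cons {w = w} k refl P) eq with ∷-injective eq
  ... | refl , rest++w≡ with ++-≡-++ (rest k) w us v rest++w≡
  ... | inj₂ (m , rest≡ , _) = endsInside k [] us m w nil P (sym rest≡) refl refl
  ... | inj₁ ([] , us≡ , _) =
    endsInside k [] (rest k) [] w nil P (++-identityʳ (rest k)) (cong (fst k ∷_) (trans us≡ (++-identityʳ (rest k)))) refl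
  ... | inj₁ (c′ ∷ m , us≡ , w≡) with prefixEndsInside P w≡
  ... | endsInside k′ x ys y′ z Px Pz rest≡ prefix≡ word≡ =
    endsInside k′ (label k ++ x) ys y′ z (cons k refl Px) Pz rest≡
      (cong (fst k ∷_) (trans us≡ (trans (cong (rest k ++_) prefix≡) (sym (++-assoc (rest k) x _)))))
      (trans (cong (label k ++_) word≡) (sym (++-assoc (label k) x _)))

  module _ (T : List A) (suffixes : RecognizesSuffixes T) where

    -- The position in T of the first character of edge k, read off the chosen tail.
    anchor : Fin edges → ℕ
    anchor k = length T ∸ (length (label k) + tailLength (length T) (tgt k))

    anchoredOccurrence : ∀ k {x ys y′} → Path source (src k) x → ReachesSinkWithin (length T) (tgt k) →
      ys ++ y′ ≡ rest k → ∃ λ i → ∃ λ v → drop i T ≡ (x ++ fst k ∷ ys) ++ v × anchor k ≡ i + length x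
    anchoredOccurrence k {x} {ys} {y′} Px reach rest≡ with chosenTail (length T) (tgt k) reach
    ... | z , Pz , z≡tail with proj₁ suffixes (x ++ label k ++ z) (Px ++ᵖ cons k refl Pz)
    ... | i , i<n , word≡drop = i , y′ ++ z , trans (sym word≡drop) regraft , anchor≡
      where
      open ≡-Reasoning
      regraft : x ++ label k ++ z ≡ (x ++ fst k ∷ ys) ++ y′ ++ z
      regraft = begin
        x ++ fst k ∷ rest k ++ z         ≡⟨ cong (λ r → x ++ fst k ∷ r ++ z) rest≡ ⟨
        x ++ fst k ∷ (ys ++ y′) ++ z     ≡⟨ cong (λ r → x ++ fst k ∷ r) (++-assoc ys y′ z) ⟩
        x ++ fst k ∷ ys ++ y′ ++ z       ≡⟨ ++-assoc x (fst k ∷ ys) (y′ ++ z) ⟨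
        (x ++ fst k ∷ ys) ++ y′ ++ z     ∎
      anchor≡ : anchor k ≡ i + length x
      anchor≡ = begin
        anchor k                                  ≡⟨ cong (λ t → length T ∸ (length (label k) + t)) z≡tail ⟨
        length T ∸ (length (label k) + length z)  ≡⟨ cong (length T ∸_) (length-++ (label k)) ⟨
        length T ∸ length (label k ++ z)          ≡⟨ drop-offset T x (label k ++ z) (<⇒≤ i<n) (sym word≡drop) ⟨
        i + length x                              ∎

    -- The filter discards only junk anchors, and those arise only when T = [].
    Γ : List ℕ
    Γ = filter (_<? length T) (tabulate anchor)

    CoveredOccurrence : List A → Set
    CoveredOccurrence u = Σ ℕ λ i → Σ ℕ λ j →
      i ≤ j × j < length T × substr T i j ≡ u × Σ ℕ λ p → p ∈ Γ × i ≤ p × p ≤ j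

    spelledPrefixCovered : ∀ {w c us v} → Path source sink w → w ≡ (c ∷ us) ++ v → CoveredOccurrence (c ∷ us)
    spelledPrefixCovered {w} {us = us} P w≡ with prefixEndsInside P w≡
    ... | endsInside k x ys y′ z Px Pz rest≡ prefix≡ word≡
      with anchoredOccurrence k Px (z , Pz , tailBound) rest≡
      where
      tailBound : edgeCount Pz ≤ length T
      tailBound = begin
        edgeCount Pz                 ≤⟨ edgeCount≤length Pz ⟩
        length z                     ≤⟨ length-≤-length-++ (label k) z ⟩
        length (label k ++ z)        ≤⟨ length-≤-length-++ x _ ⟩
        length (x ++ label k ++ z)   ≡⟨ cong length word≡ ⟨
        length w                     ≤⟨ suffix-length≤ (proj₁ suffixes w P) ⟩
        length T                     ∎
        where open ≤-Reasoning
    ... | i , v′ , drop≡ , anchor≡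
      with occurrence-substr T i (trans drop≡ (cong (_++ v′) (sym prefix≡)))
    ... | j<n , substr≡ =
      i , i + length us , m≤m+n i _ , j<n , substr≡ ,
      anchor k , ∈-filter⁺ (_<? length T) (∈-tabulate⁺ k) (≤-<-trans anchor≤j j<n) ,
      subst (i ≤_) (sym anchor≡) (m≤m+n i _) , anchor≤j
      where
      anchor≤j : anchor k ≤ i + length us
      anchor≤j = subst (_≤ i + length us) (sym anchor≡) (+-monoʳ-≤ i (∷≡++∷⇒length≤ us x ys prefix≡))

    isStringAttractor : IsStringAttractor T Γ
    isStringAttractor = all-filter (_<? length T) (tabulate anchor) , covered
      where
      covered : ∀ i j → i ≤ j → j < length T → CoveredOccurrence (substr T i j)
      covered i j i≤j j<n with substr-split T i≤j j<n
      ... | c , us , v , substr≡ , drop≡ rewrite substr≡ =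
        spelledPrefixCovered (proj₂ suffixes (drop i T) (i , ≤-<-trans i≤j j<n , refl)) drop≡

    length-Γ≤edges : length Γ ≤ edges
    length-Γ≤edges = ≤-trans (length-filter (_<? length T) (tabulate anchor)) (≤-reflexive (length-tabulate anchor))

theorem3p10 : {A : Set} (T : List A) (𝒜 : CompactAutomaton A) →
    IsCompactAutomatonFor 𝒜 T →
    Σ (List ℕ) λ Γ → IsStringAttractor T Γ × length Γ ≤ CompactAutomaton.edges 𝒜
theorem3p10 T 𝒜 (_ , _ , suffixes) = Γ 𝒜 T suffixes , isStringAttractor 𝒜 T suffixes , length-Γ≤edges 𝒜 T suffixes
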